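{- Let $f_{2^k,n}:=\sum_{j=0}^{n}\binom{n}{j}(-1)^{\binom{j}{2^k}}$. For all integers $k,\nu\geq 1$ we have \[f_{2^k,\nu\cdot 2^{k+1}-2}=f_{2^k,\nu\cdot 2^{k+1}-3},\qquad f_{2^k,(2\nu-1)2^{k}-1}=2f_{2^k,(2\nu-1)2^{k}-2}.\]
   Context: Here $\binom{j}{m}=0$ for $0\le j<m$; $f_{2^k,n}$ is the value at $z=-1$ of $f_{2^k,n}(z)=\sum_{j=0}^{n}\binom{n}{j}z^{\binom{j}{2^k}}$. -}

module Defs where

open import Data.Nat using (ℕ; zero; suc)
open import Data.Nat.Combinatorics using (_C_)
open import Data.Integer using (ℤ; +_; -1ℤ; _^_) renaming (_+_ to _+ℤ_; _*_ to _*ℤ_)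

sumTo : ℕ → (ℕ → ℤ) → ℤ
sumTo zero    g = g 0
sumTo (suc N) g = sumTo N g +ℤ g (suc N)

f : ℕ → ℕ → ℤ
f m n = sumTo n (λ j → (+ (n C j)) *ℤ (-1ℤ ^ (j C m)))

-- Write s j = (-1)^C(j,2^k). Lucas's theorem mod 2, in the form
-- C(2n,2j) ≡ C(n,j), C(2n,2j+1) ≡ 0 and C(2n+1,2j) ≡ C(n,j) (mod 2), makes s antiperiodic:
-- s (j + 2^k) = - s j. Hence s x = (-1)^(c+1) s y whenever x + y + 1 = c·2^k.
-- Pascal's rule gives f (n+1) = Σ C(n,j) (s j + s (j+1)), and since C(n,j) = C(n,n-j),
-- a binomial sum of a sequence antisymmetric under j ↦ n - j vanishes. For even c
-- the sequence j ↦ s (j+1) is such, so f (n+1) = f n; for odd c it is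
-- j ↦ s (j+1) - s j, so f (n+1) = 2 f n.
module Submission where

open import Defs
open import Data.Nat using (ℕ; zero; suc; _+_; _*_; _∸_; _^_; _≥_; _≤_; _<_; z≤n; s≤s)
open import Data.Nat.Properties
  using (+-suc; +-comm; +-assoc; +-cancelˡ-≡; *-suc; ≤-refl; m≤n⇒m≤1+n; m≤n+m; m+n∸n≡m; m∸n+n≡m;
         _≤?_; ≰⇒>; m≤n⇒∃[o]m+o≡n; *-mono-≤; ^-monoʳ-≤; ∸-monoʳ-<; n<1+n)
import Data.Nat.Properties as ℕ
import Data.Integer.Properties as ℤ
open import Data.Nat.Tactic.RingSolver using () renaming (solve-∀ to ℕ-solve-∀)
open import Data.Nat.Combinatorics using (_C_; nCk+nC[k+1]≡[n+1]C[k+1]; k>n⇒nCk≡0; nCk≡nC[n∸k]; nC1≡n)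
open import Data.Integer using (ℤ; +_; -[1+_]; -1ℤ; 0ℤ; 1ℤ; -_)
  renaming (_+_ to _+ℤ_; _*_ to _*ℤ_; _^_ to _^ℤ_)
open import Data.Integer.Properties
  using (^-distribˡ-+-*; ^-*-assoc; ^-zeroˡ; *-assoc; *-identityʳ; *-identityˡ; *-distribˡ-+; *-distribʳ-+;
         +-identityʳ; neg-distrib-+; neg-distribʳ-*; -1*i≡-i; pos-+)
open import Data.Integer.Tactic.RingSolver using (solve-∀)
open import Data.Product using (_×_; _,_)
open import Relation.Nullary using (yes; no)
open import Relation.Binary.PropositionalEquality
open ≡-Reasoning

a+b≡c+d⇒b≡[c∸a]+d : ∀ {a b c d} → a ≤ c → a + b ≡ c + d → b ≡ (c ∸ a) + d
a+b≡c+d⇒b≡[c∸a]+d {a} {b} {c} {d} a≤c e = +-cancelˡ-≡ a b ((c ∸ a) + d) (begin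
  a + b             ≡⟨ e ⟩
  c + d             ≡⟨ cong (_+ d) (sym (m∸n+n≡m a≤c)) ⟩
  (c ∸ a) + a + d   ≡⟨ cong (_+ d) (+-comm (c ∸ a) a) ⟩
  a + (c ∸ a) + d   ≡⟨ +-assoc a (c ∸ a) d ⟩
  a + ((c ∸ a) + d) ∎)

double : ℕ → ℕ
double zero    = zero
double (suc n) = suc (suc (double n))

2*n≡double : ∀ n → 2 * n ≡ double n
2*n≡double zero    = refl
2*n≡double (suc n) = cong suc (trans (+-suc n (n + 0)) (cong suc (2*n≡double n)))

double-+ : ∀ a b → double a + double b ≡ double (a + b)
double-+ zero    b = refl
double-+ (suc a) b = cong (λ n → suc (suc n)) (double-+ a b)

data Parity : ℕ → Set where
  even : ∀ a → Parity (double a)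
  odd  : ∀ a → Parity (suc (double a))

parity : ∀ j → Parity j
parity zero          = even zero
parity (suc zero)    = odd zero
parity (suc (suc j)) with parity j
... | even a = even (suc a)
... | odd a  = odd (suc a)

sign : ℕ → ℤ
sign n = -1ℤ ^ℤ n

sign-+ : ∀ a b → sign (a + b) ≡ sign a *ℤ sign b
sign-+ = ^-distribˡ-+-* -1ℤ

sign-2* : ∀ n → sign (2 * n) ≡ 1ℤ
sign-2* n = trans (sym (^-*-assoc -1ℤ 2 n)) (^-zeroˡ n)

sign-double : ∀ n → sign (double n) ≡ 1ℤ
sign-double n = trans (cong sign (sym (2*n≡double n))) (sign-2* n)

sign-square : ∀ a → sign a *ℤ sign a ≡ 1ℤ
sign-square zero    = refl
sign-square (suc a) = trans (negate-twice (sign a)) (sign-square a)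
  where
  negate-twice : ∀ x → (-1ℤ *ℤ x) *ℤ (-1ℤ *ℤ x) ≡ x *ℤ x
  negate-twice = solve-∀

sign-C-suc : ∀ n k → sign (suc n C suc k) ≡ sign (n C k) *ℤ sign (n C suc k)
sign-C-suc n k = trans (cong sign (sym (nCk+nC[k+1]≡[n+1]C[k+1] n k))) (sign-+ (n C k) (n C suc k))

sign-C-suc-suc : ∀ n k → sign (suc (suc n) C suc (suc k)) ≡ sign (n C k) *ℤ sign (n C suc (suc k))
sign-C-suc-suc n k = begin
  sign (suc (suc n) C suc (suc k))                  ≡⟨ sign-C-suc (suc n) (suc k) ⟩
  sign (suc n C suc k) *ℤ sign (suc n C suc (suc k)) ≡⟨ cong₂ _*ℤ_ (sign-C-suc n k) (sign-C-suc n (suc k)) ⟩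
  (a *ℤ b) *ℤ (b *ℤ c)                                ≡⟨ regroup a b c ⟩
  (a *ℤ c) *ℤ (b *ℤ b)                                ≡⟨ cong ((a *ℤ c) *ℤ_) (sign-square (n C suc k)) ⟩
  (a *ℤ c) *ℤ 1ℤ                                      ≡⟨ *-identityʳ (a *ℤ c) ⟩
  a *ℤ c                                              ∎
  where
  a b c : ℤ
  a = sign (n C k)
  b = sign (n C suc k)
  c = sign (n C suc (suc k))
  regroup : ∀ x y z → (x *ℤ y) *ℤ (y *ℤ z) ≡ (x *ℤ z) *ℤ (y *ℤ y)
  regroup = solve-∀

sign-C-double-double : ∀ n j → sign (double n C double j) ≡ sign (n C j)
sign-C-double-double zero    zero    = refl
sign-C-double-double zero    (suc j) = refl
sign-C-double-double (suc n) zero    = refl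
sign-C-double-double (suc n) (suc j) = begin
  sign (double (suc n) C double (suc j))                       ≡⟨ sign-C-suc-suc (double n) (double j) ⟩
  sign (double n C double j) *ℤ sign (double n C double (suc j)) ≡⟨ cong₂ _*ℤ_ (sign-C-double-double n j)
                                                                                (sign-C-double-double n (suc j)) ⟩
  sign (n C j) *ℤ sign (n C suc j)                             ≡⟨ sign-C-suc n j ⟨
  sign (suc n C suc j)                                         ∎

sign-C-double-odd : ∀ n j → sign (double n C suc (double j)) ≡ 1ℤ
sign-C-double-odd zero    j       = refl
sign-C-double-odd (suc n) zero    = trans (cong sign (nC1≡n (double (suc n)))) (sign-double (suc n))
sign-C-double-odd (suc n) (suc j) = begin
  sign (double (suc n) C suc (double (suc j)))                         ≡⟨ sign-C-suc-suc (double n) (suc (double j)) ⟩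
  sign (double n C suc (double j)) *ℤ sign (double n C suc (double (suc j))) ≡⟨ cong₂ _*ℤ_ (sign-C-double-odd n j)
                                                                                        (sign-C-double-odd n (suc j)) ⟩
  1ℤ                                                                   ∎

sign-C-odd-double : ∀ n j → sign (suc (double n) C double j) ≡ sign (n C j)
sign-C-odd-double n zero    = refl
sign-C-odd-double n (suc j) = begin
  sign (suc (double n) C double (suc j))                               ≡⟨ sign-C-suc (double n) (suc (double j)) ⟩
  sign (double n C suc (double j)) *ℤ sign (double n C double (suc j)) ≡⟨ cong₂ _*ℤ_ (sign-C-double-odd n j)
                                                                                (sign-C-double-double n (suc j)) ⟩
  1ℤ *ℤ sign (n C suc j)                                               ≡⟨ *-identityˡ (sign (n C suc j)) ⟩
  sign (n C suc j)                                                     ∎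

sign-C-2^k-antiperiodic : ∀ k j → sign ((j + 2 ^ k) C 2 ^ k) ≡ -1ℤ *ℤ sign (j C 2 ^ k)
sign-C-2^k-antiperiodic zero j = begin
  sign ((j + 1) C 1)   ≡⟨ cong sign (nC1≡n (j + 1)) ⟩
  sign (j + 1)         ≡⟨ cong sign (+-comm j 1) ⟩
  sign (suc j)         ≡⟨ cong (λ n → -1ℤ *ℤ sign n) (nC1≡n j) ⟨
  -1ℤ *ℤ sign (j C 1) ∎
sign-C-2^k-antiperiodic (suc k) j rewrite 2*n≡double (2 ^ k) with parity j
... | even a = begin
  sign ((double a + double M) C double M)     ≡⟨ cong (λ n → sign (n C double M)) (double-+ a M) ⟩
  sign (double (a + M) C double M)            ≡⟨ sign-C-double-double (a + M) M ⟩
  sign ((a + M) C M)                          ≡⟨ sign-C-2^k-antiperiodic k a ⟩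
  -1ℤ *ℤ sign (a C M)                         ≡⟨ cong (-1ℤ *ℤ_) (sign-C-double-double a M) ⟨
  -1ℤ *ℤ sign (double a C double M)           ∎
  where
  M : ℕ
  M = 2 ^ k
... | odd a = begin
  sign (suc (double a + double M) C double M) ≡⟨ cong (λ n → sign (suc n C double M)) (double-+ a M) ⟩
  sign (suc (double (a + M)) C double M)      ≡⟨ sign-C-odd-double (a + M) M ⟩
  sign ((a + M) C M)                          ≡⟨ sign-C-2^k-antiperiodic k a ⟩
  -1ℤ *ℤ sign (a C M)                         ≡⟨ cong (-1ℤ *ℤ_) (sign-C-odd-double a M) ⟨
  -1ℤ *ℤ sign (suc (double a) C double M)     ∎
  where
  M : ℕ
  M = 2 ^ k

sign-C-below : ∀ {m j} → j < m → sign (j C m) ≡ 1ℤ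
sign-C-below j<m = cong sign (k>n⇒nCk≡0 j<m)

module Antiperiodic (m : ℕ) (s : ℕ → ℤ)
                    (antiperiodic : ∀ j → s (j + m) ≡ -1ℤ *ℤ s j)
                    (one-below : ∀ {j} → j < m → s j ≡ 1ℤ) where

  shift-multiple : ∀ c j → s (j + c * m) ≡ sign c *ℤ s j
  shift-multiple zero    j = trans (cong s (ℕ.+-identityʳ j)) (sym (*-identityˡ (s j)))
  shift-multiple (suc c) j = begin
    s (j + (m + c * m))        ≡⟨ cong s (regroup j m (c * m)) ⟩
    s ((j + c * m) + m)        ≡⟨ antiperiodic (j + c * m) ⟩
    -1ℤ *ℤ s (j + c * m)       ≡⟨ cong (-1ℤ *ℤ_) (shift-multiple c j) ⟩
    -1ℤ *ℤ (sign c *ℤ s j)     ≡⟨ *-assoc -1ℤ (sign c) (s j) ⟨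
    sign (suc c) *ℤ s j        ∎
    where
    regroup : ∀ a b c → a + (b + c) ≡ (a + c) + b
    regroup = ℕ-solve-∀

  reflect : ∀ c x y → suc (x + y) ≡ c * m → s x ≡ sign (suc c) *ℤ s y
  reflect zero    x y ()
  reflect (suc c) x y e with m ≤? x
  ... | yes m≤x with m≤n⇒∃[o]m+o≡n m≤x
  ...   | x′ , refl = begin
    s (m + x′)                  ≡⟨ cong s (+-comm m x′) ⟩
    s (x′ + m)                  ≡⟨ antiperiodic x′ ⟩
    -1ℤ *ℤ s x′                 ≡⟨ cong (-1ℤ *ℤ_) (reflect c x′ y (+-cancelˡ-≡ m _ _ (trans (regroup m x′ y) e))) ⟩
    -1ℤ *ℤ (sign (suc c) *ℤ s y) ≡⟨ *-assoc -1ℤ (sign (suc c)) (s y) ⟨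
    sign (suc (suc c)) *ℤ s y   ∎
    where
    regroup : ∀ a b c → a + suc (b + c) ≡ suc (a + b + c)
    regroup = ℕ-solve-∀
  reflect (suc c) x y e | no m≰x = begin
    s x                                       ≡⟨ one-below x<m ⟩
    1ℤ                                        ≡⟨ sign-square c ⟨
    sign c *ℤ sign c                          ≡⟨ regroup (sign c) ⟩
    sign (suc (suc c)) *ℤ (sign c *ℤ 1ℤ)      ≡⟨ cong (λ t → sign (suc (suc c)) *ℤ (sign c *ℤ t)) (one-below r<m) ⟨
    sign (suc (suc c)) *ℤ (sign c *ℤ s r)     ≡⟨ cong (sign (suc (suc c)) *ℤ_) (shift-multiple c r) ⟨
    sign (suc (suc c)) *ℤ s (r + c * m)       ≡⟨ cong (λ t → sign (suc (suc c)) *ℤ s t) y≡r+cm ⟨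
    sign (suc (suc c)) *ℤ s y                 ∎
    where
    x<m : x < m
    x<m = ≰⇒> m≰x
    r : ℕ
    r = m ∸ suc x
    r<m : r < m
    r<m = ∸-monoʳ-< (s≤s z≤n) x<m
    y≡r+cm : y ≡ r + c * m
    y≡r+cm = a+b≡c+d⇒b≡[c∸a]+d x<m e
    regroup : ∀ a → a *ℤ a ≡ (-1ℤ *ℤ (-1ℤ *ℤ a)) *ℤ (a *ℤ 1ℤ)
    regroup = solve-∀

sumTo-cong : ∀ n {g h : ℕ → ℤ} → (∀ j → j ≤ n → g j ≡ h j) → sumTo n g ≡ sumTo n h
sumTo-cong zero    g≗h = g≗h 0 z≤n
sumTo-cong (suc n) g≗h = cong₂ _+ℤ_ (sumTo-cong n (λ j j≤n → g≗h j (m≤n⇒m≤1+n j≤n))) (g≗h (suc n) ≤-refl)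

sumTo-+ : ∀ n (g h : ℕ → ℤ) → sumTo n (λ j → g j +ℤ h j) ≡ sumTo n g +ℤ sumTo n h
sumTo-+ zero    g h = refl
sumTo-+ (suc n) g h = trans (cong (_+ℤ (g (suc n) +ℤ h (suc n))) (sumTo-+ n g h))
                            (interchange (sumTo n g) (sumTo n h) (g (suc n)) (h (suc n)))
  where
  interchange : ∀ a b c d → (a +ℤ b) +ℤ (c +ℤ d) ≡ (a +ℤ c) +ℤ (b +ℤ d)
  interchange = solve-∀

sumTo-neg : ∀ n (g : ℕ → ℤ) → sumTo n (λ j → - g j) ≡ - sumTo n g
sumTo-neg zero    g = refl
sumTo-neg (suc n) g = trans (cong (_+ℤ - g (suc n)) (sumTo-neg n g)) (sym (neg-distrib-+ (sumTo n g) (g (suc n))))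

sumTo-suc : ∀ n (g : ℕ → ℤ) → sumTo (suc n) g ≡ g 0 +ℤ sumTo n (λ j → g (suc j))
sumTo-suc zero    g = refl
sumTo-suc (suc n) g = trans (cong (_+ℤ g (suc (suc n))) (sumTo-suc n g)) (ℤ.+-assoc (g 0) _ _)

sumTo-reverse : ∀ n (g : ℕ → ℤ) → sumTo n (λ j → g (n ∸ j)) ≡ sumTo n g
sumTo-reverse zero    g = refl
sumTo-reverse (suc n) g = begin
  sumTo (suc n) (λ j → g (suc n ∸ j)) ≡⟨ sumTo-suc n (λ j → g (suc n ∸ j)) ⟩
  g (suc n) +ℤ sumTo n (λ j → g (n ∸ j)) ≡⟨ cong (g (suc n) +ℤ_) (sumTo-reverse n g) ⟩
  g (suc n) +ℤ sumTo n g              ≡⟨ ℤ.+-comm (g (suc n)) (sumTo n g) ⟩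
  sumTo (suc n) g                     ∎

i≡-i⇒i≡0 : ∀ {i} → i ≡ - i → i ≡ 0ℤ
i≡-i⇒i≡0 {+ zero}    _ = refl
i≡-i⇒i≡0 {+ suc _}   ()
i≡-i⇒i≡0 { -[1+ _ ]} ()

sumTo-antisymmetric : ∀ n (g : ℕ → ℤ) → (∀ x y → x + y ≡ n → g x ≡ - g y) → sumTo n g ≡ 0ℤ
sumTo-antisymmetric n g anti = i≡-i⇒i≡0 (begin
  sumTo n g                 ≡⟨ sumTo-reverse n g ⟨
  sumTo n (λ j → g (n ∸ j)) ≡⟨ sumTo-cong n (λ j j≤n → anti (n ∸ j) j (m∸n+n≡m j≤n)) ⟩
  sumTo n (λ j → - g j)     ≡⟨ sumTo-neg n g ⟩
  - sumTo n g               ∎)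

C-symmetric : ∀ x y → (x + y) C x ≡ (x + y) C y
C-symmetric x y = sym (trans (nCk≡nC[n∸k] (m≤n+m y x)) (cong ((x + y) C_) (m+n∸n≡m x y)))

binomialSum : ℕ → (ℕ → ℤ) → ℤ
binomialSum n t = sumTo n (λ j → + (n C j) *ℤ t j)

binomialSum-+ : ∀ n (t u : ℕ → ℤ) → binomialSum n (λ j → t j +ℤ u j) ≡ binomialSum n t +ℤ binomialSum n u
binomialSum-+ n t u =
  trans (sumTo-cong n (λ j _ → *-distribˡ-+ (+ (n C j)) (t j) (u j))) (sumTo-+ n _ _)

binomialSum-cong : ∀ n {t u : ℕ → ℤ} → (∀ j → t j ≡ u j) → binomialSum n t ≡ binomialSum n u
binomialSum-cong n t≗u = sumTo-cong n (λ j _ → cong (+ (n C j) *ℤ_) (t≗u j))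

binomialSum-antisymmetric : ∀ n (t : ℕ → ℤ) → (∀ x y → x + y ≡ n → t x ≡ - t y) → binomialSum n t ≡ 0ℤ
binomialSum-antisymmetric n t anti = sumTo-antisymmetric n _ λ where
  x y refl → begin
    + ((x + y) C x) *ℤ t x   ≡⟨ cong₂ (λ a b → + a *ℤ b) (C-symmetric x y) (anti x y refl) ⟩
    + ((x + y) C y) *ℤ - t y ≡⟨ neg-distribʳ-* (+ ((x + y) C y)) (t y) ⟨
    - (+ ((x + y) C y) *ℤ t y) ∎

binomialSum-suc : ∀ n (t : ℕ → ℤ) → binomialSum (suc n) t ≡ binomialSum n t +ℤ binomialSum n (λ j → t (suc j))
binomialSum-suc n t = begin
  binomialSum (suc n) t                               ≡⟨ sumTo-suc n _ ⟩
  1ℤ *ℤ t 0 +ℤ sumTo n (λ j → + (suc n C suc j) *ℤ t (suc j)) ≡⟨ cong₂ _+ℤ_ (*-identityˡ (t 0)) (sumTo-cong n λ j _ → pascal j) ⟩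
  t 0 +ℤ sumTo n (λ j → + (n C j) *ℤ t (suc j) +ℤ + (n C suc j) *ℤ t (suc j)) ≡⟨ cong (t 0 +ℤ_) (sumTo-+ n _ _) ⟩
  t 0 +ℤ (S′ +ℤ U)                                    ≡⟨ rearrange (t 0) S′ U ⟩
  (t 0 +ℤ U) +ℤ S′                                    ≡⟨ cong (_+ℤ S′) lower-sum ⟨
  binomialSum n t +ℤ S′                               ∎
  where
  S′ U : ℤ
  S′ = binomialSum n (λ j → t (suc j))
  U  = sumTo n (λ j → + (n C suc j) *ℤ t (suc j))
  rearrange : ∀ a b c → a +ℤ (b +ℤ c) ≡ (a +ℤ c) +ℤ b
  rearrange = solve-∀
  pascal : ∀ j → + (suc n C suc j) *ℤ t (suc j) ≡ + (n C j) *ℤ t (suc j) +ℤ + (n C suc j) *ℤ t (suc j)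
  pascal j = begin
    + (suc n C suc j) *ℤ t (suc j)                   ≡⟨ cong (λ a → + a *ℤ t (suc j)) (nCk+nC[k+1]≡[n+1]C[k+1] n j) ⟨
    + (n C j + n C suc j) *ℤ t (suc j)               ≡⟨ cong (_*ℤ t (suc j)) (pos-+ (n C j) (n C suc j)) ⟩
    (+ (n C j) +ℤ + (n C suc j)) *ℤ t (suc j)        ≡⟨ *-distribʳ-+ (t (suc j)) (+ (n C j)) (+ (n C suc j)) ⟩
    + (n C j) *ℤ t (suc j) +ℤ + (n C suc j) *ℤ t (suc j) ∎
  lower-sum : binomialSum n t ≡ t 0 +ℤ U
  lower-sum = begin
    binomialSum n t                                  ≡⟨ +-identityʳ (binomialSum n t) ⟨
    binomialSum n t +ℤ 0ℤ                            ≡⟨ cong (λ a → binomialSum n t +ℤ + a *ℤ t (suc n)) (k>n⇒nCk≡0 (n<1+n n)) ⟨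
    sumTo (suc n) (λ j → + (n C j) *ℤ t j)           ≡⟨ sumTo-suc n _ ⟩
    1ℤ *ℤ t 0 +ℤ U                                   ≡⟨ cong (_+ℤ U) (*-identityˡ (t 0)) ⟩
    t 0 +ℤ U                                         ∎

binomialSum-suc-of-antisymmetric : ∀ n (t : ℕ → ℤ) → (∀ x y → x + y ≡ suc (suc n) → t x ≡ - t y) →
                                   binomialSum (suc n) t ≡ binomialSum n t
binomialSum-suc-of-antisymmetric n t anti = begin
  binomialSum (suc n) t                                  ≡⟨ binomialSum-suc n t ⟩
  binomialSum n t +ℤ binomialSum n (λ j → t (suc j))     ≡⟨ cong (binomialSum n t +ℤ_) (binomialSum-antisymmetric n _ anti′) ⟩
  binomialSum n t +ℤ 0ℤ                                  ≡⟨ +-identityʳ (binomialSum n t) ⟩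
  binomialSum n t                                        ∎
  where
  anti′ : ∀ x y → x + y ≡ n → t (suc x) ≡ - t (suc y)
  anti′ x y x+y≡n = anti (suc x) (suc y) (cong suc (trans (+-suc x y) (cong suc x+y≡n)))

binomialSum-suc-of-symmetric : ∀ n (t : ℕ → ℤ) → (∀ x y → x + y ≡ suc n → t x ≡ t y) →
                               binomialSum (suc n) t ≡ + 2 *ℤ binomialSum n t
binomialSum-suc-of-symmetric n t sym-t = begin
  binomialSum (suc n) t                                  ≡⟨ binomialSum-suc n t ⟩
  B +ℤ binomialSum n (λ j → t (suc j))                   ≡⟨ cong (B +ℤ_) (binomialSum-cong n (λ j → split (t j) (t (suc j)))) ⟩
  B +ℤ binomialSum n (λ j → t j +ℤ Δ j)                  ≡⟨ cong (B +ℤ_) (binomialSum-+ n t Δ) ⟩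
  B +ℤ (B +ℤ binomialSum n Δ)                            ≡⟨ cong (λ a → B +ℤ (B +ℤ a)) (binomialSum-antisymmetric n Δ Δ-anti) ⟩
  B +ℤ (B +ℤ 0ℤ)                                         ≡⟨ twice B ⟩
  + 2 *ℤ B                                               ∎
  where
  B : ℤ
  B = binomialSum n t
  Δ : ℕ → ℤ
  Δ j = t (suc j) +ℤ - t j
  split : ∀ a b → b ≡ a +ℤ (b +ℤ - a)
  split = solve-∀
  twice : ∀ a → a +ℤ (a +ℤ 0ℤ) ≡ + 2 *ℤ a
  twice = solve-∀
  swap-difference : ∀ a b → a +ℤ - b ≡ - (b +ℤ - a)
  swap-difference = solve-∀
  Δ-anti : ∀ x y → x + y ≡ n → Δ x ≡ - Δ y
  Δ-anti x y x+y≡n = begin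
    t (suc x) +ℤ - t x       ≡⟨ cong₂ (λ a b → a +ℤ - b) (sym-t (suc x) y (cong suc x+y≡n))
                                                         (sym-t x (suc y) (trans (+-suc x y) (cong suc x+y≡n))) ⟩
    t y +ℤ - t (suc y)       ≡⟨ swap-difference (t y) (t (suc y)) ⟩
    - Δ y                    ∎

module _ (k : ℕ) where

  private
    s : ℕ → ℤ
    s j = sign (j C 2 ^ k)

  open Antiperiodic (2 ^ k) s (sign-C-2^k-antiperiodic k) sign-C-below

  f-2^k-at-even-multiple : ∀ c → sign c ≡ 1ℤ → f (2 ^ k) (c * 2 ^ k ∸ 2) ≡ f (2 ^ k) (c * 2 ^ k ∸ 3)
  f-2^k-at-even-multiple c c-even = at (c * 2 ^ k) refl
    where
    at : ∀ N → N ≡ c * 2 ^ k → f (2 ^ k) (N ∸ 2) ≡ f (2 ^ k) (N ∸ 3)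
    -- for N ≤ 2 both arguments are truncated to 0
    at 0 _ = refl
    at 1 _ = refl
    at 2 _ = refl
    at (suc (suc (suc n))) N≡c2^k = binomialSum-suc-of-antisymmetric n s anti
      where
      anti : ∀ x y → x + y ≡ suc (suc n) → s x ≡ - s y
      anti x y x+y≡ = begin
        s x                         ≡⟨ reflect c x y (trans (cong suc x+y≡) N≡c2^k) ⟩
        (-1ℤ *ℤ sign c) *ℤ s y      ≡⟨ cong (λ a → (-1ℤ *ℤ a) *ℤ s y) c-even ⟩
        -1ℤ *ℤ s y                  ≡⟨ -1*i≡-i (s y) ⟩
        - s y                       ∎

  f-2^k-at-odd-multiple : ∀ c → 2 ≤ c * 2 ^ k → sign c ≡ -1ℤ →
                          f (2 ^ k) (c * 2 ^ k ∸ 1) ≡ + 2 *ℤ f (2 ^ k) (c * 2 ^ k ∸ 2)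
  f-2^k-at-odd-multiple c 2≤c2^k c-odd with m≤n⇒∃[o]m+o≡n 2≤c2^k
  ... | n , 2+n≡c2^k rewrite sym 2+n≡c2^k = binomialSum-suc-of-symmetric n s symm
    where
    symm : ∀ x y → x + y ≡ suc n → s x ≡ s y
    symm x y x+y≡ = begin
      s x                         ≡⟨ reflect c x y (trans (cong suc x+y≡) 2+n≡c2^k) ⟩
      (-1ℤ *ℤ sign c) *ℤ s y      ≡⟨ cong (λ a → (-1ℤ *ℤ a) *ℤ s y) c-odd ⟩
      1ℤ *ℤ s y                   ≡⟨ *-identityˡ (s y) ⟩
      s y                         ∎

corollary5p6 : (k ν : ℕ) → k ≥ 1 → ν ≥ 1 →
    (f (2 ^ k) (ν * 2 ^ (k + 1) ∸ 2) ≡ f (2 ^ k) (ν * 2 ^ (k + 1) ∸ 3))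
    × (f (2 ^ k) ((2 * ν ∸ 1) * 2 ^ k ∸ 1) ≡ (+ 2) *ℤ f (2 ^ k) ((2 * ν ∸ 1) * 2 ^ k ∸ 2))
corollary5p6 k ν@(suc ν′) k≥1 _ =
  subst (λ N → f (2 ^ k) (N ∸ 2) ≡ f (2 ^ k) (N ∸ 3)) (sym ν*2^[k+1]≡2ν*2^k)
        (f-2^k-at-even-multiple k (2 * ν) (sign-2* ν)) ,
  f-2^k-at-odd-multiple k (2 * ν ∸ 1) (*-mono-≤ 1≤2ν-1 (^-monoʳ-≤ 2 k≥1)) sign[2ν-1]≡-1
  where
  ν*2^[k+1]≡2ν*2^k : ν * 2 ^ (k + 1) ≡ 2 * ν * 2 ^ k
  ν*2^[k+1]≡2ν*2^k = trans (cong (λ e → ν * 2 ^ e) (+-comm k 1)) (reassociate ν (2 ^ k))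
    where
    reassociate : ∀ a b → a * (2 * b) ≡ 2 * a * b
    reassociate = ℕ-solve-∀
  2ν-1≡1+2ν′ : 2 * ν ∸ 1 ≡ suc (2 * ν′)
  2ν-1≡1+2ν′ = cong (_∸ 1) (*-suc 2 ν′)
  1≤2ν-1 : 1 ≤ 2 * ν ∸ 1
  1≤2ν-1 = subst (1 ≤_) (sym 2ν-1≡1+2ν′) (s≤s z≤n)
  sign[2ν-1]≡-1 : sign (2 * ν ∸ 1) ≡ -1ℤ
  sign[2ν-1]≡-1 = trans (cong sign 2ν-1≡1+2ν′) (cong (-1ℤ *ℤ_) (sign-2* ν′))
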